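{- Let $D$ be a connected acyclic digraph with at least $3$ vertices. The following are equivalent: (i) $\langle D\rangle$ is a band; (ii) $\langle D\rangle$ is completely regular; (iii) $\langle D\rangle$ is regular; (iv) $D$ is directed-bipartite.
   Context: For $a\neq b$ in $\{1,\ldots,n\}$, $(a\to b)$ denotes the transformation mapping $a$ to $b$ and fixing every other point; transformations are composed left to right. For a digraph $D$ on $\{1,\ldots,n\}$ (no loops, no multiple arcs), $\langle D\rangle$ is the semigroup generated by all $(a\to b)$ with $(a,b)$ an arc. Connected means the underlying undirected graph is connected; acyclic means no directed cycle. A band is a semigroup of idempotents; completely regular means every element lies in a subgroup; regular means for every $x$ there is $y$ with $xyx=x$. $D$ is directed-bipartite if its vertex set can be partitioned into $V_1,V_2$ such that every arc $(a,b)$ has $a\in V_1$ and $b\in V_2$. -}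

module Defs where

open import Level using (0ℓ)
open import Data.Nat using (ℕ; _≥_)
open import Data.Fin using (Fin; _≟_)
open import Data.Bool using (Bool; true; false)
open import Data.Product using (Σ; ∃; _×_; _,_)
open import Relation.Nullary using (¬_; yes; no)
open import Relation.Binary using (Rel)
open import Relation.Binary.PropositionalEquality using (_≡_; _≗_)
open import Relation.Binary.Construct.Closure.Transitive using (TransClosure)
open import Relation.Binary.Construct.Closure.Symmetric using (SymClosure)
open import Relation.Binary.Construct.Closure.ReflexiveTransitive using (Star)

Tr : ℕ → Set
Tr n = Fin n → Fin n

-- Composition left to right: (f ⨟ g) x = g (f x).
_⨟_ : ∀ {n} → Tr n → Tr n → Tr n
(f ⨟ g) x = g (f x)

edgeTr : ∀ {n} → Fin n → Fin n → Tr n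
edgeTr a b x with x ≟ a
... | yes _ = b
... | no  _ = x

-- A digraph on Fin n: an arc relation without loops (no multiple arcs is
-- automatic for a relation).
record Digraph (n : ℕ) : Set₁ where
  field
    Arc     : Rel (Fin n) 0ℓ
    noLoops : ∀ a → ¬ Arc a a
open Digraph public

-- Membership in ⟨D⟩: nonempty products of generators (a → b), (a,b) an arc.
data InGen {n} (D : Digraph n) : Tr n → Set where
  gen  : ∀ {a b} → Arc D a b → InGen D (edgeTr a b)
  comp : ∀ {f g} → InGen D f → InGen D g → InGen D (f ⨟ g)

Connected : ∀ {n} → Digraph n → Set
Connected D = ∀ a b → Star (SymClosure (Arc D)) a b

Acyclic : ∀ {n} → Digraph n → Set
Acyclic D = ∀ a → ¬ TransClosure (Arc D) a a

DirectedBipartite : ∀ {n} → Digraph n → Set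
DirectedBipartite {n} D =
  Σ (Fin n → Bool) λ inV₁ → ∀ a b → Arc D a b → (inV₁ a ≡ true) × (inV₁ b ≡ false)

IsBand : ∀ {n} → Digraph n → Set
IsBand D = ∀ f → InGen D f → (f ⨟ f) ≗ f

IsRegular : ∀ {n} → Digraph n → Set
IsRegular D = ∀ f → InGen D f → Σ _ λ g → InGen D g × ((f ⨟ g) ⨟ f) ≗ f

IsSubgroup : ∀ {n} → Digraph n → (Tr n → Set) → Set
IsSubgroup {n} D H =
  (∀ h → H h → InGen D h) ×
  (∀ h k → H h → H k → H (h ⨟ k)) ×
  Σ (Tr n) λ e → H e ×
    (∀ h → H h → ((e ⨟ h) ≗ h) × ((h ⨟ e) ≗ h)) ×
    (∀ h → H h → Σ (Tr n) λ h' → H h' × ((h ⨟ h') ≗ e) × ((h' ⨟ h) ≗ e))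

IsCompletelyRegular : ∀ {n} → Digraph n → Set₁
IsCompletelyRegular {n} D =
  ∀ f → InGen D f → Σ (Tr n → Set) λ H → IsSubgroup D H × H f

module Submission where

-- Call D "two-path-free" if it has no directed path a → b → c.
-- Every element g of ⟨D⟩ moves each point x along a directed walk from x to
-- g x, so the theorem reduces to the cycle of implications
--
--   band ⇒ completely regular ⇒ regular ⇒ two-path-free ⇒ directed-bipartite
--        ⇒ two-path-free ⇒ band.
--
-- (1) an idempotent f lies in the trivial subgroup {h ∈ ⟨D⟩ | h = f};
-- (2) an inverse of f in a subgroup containing f is a regular inverse;
-- (3) if a → b → c, regularity of f = (b→c)(a→b) forces some g ∈ ⟨D⟩ with
--     g b = a, i.e. a walk b ⇝ a closing a directed cycle (needs acyclicity);
-- (4) in a connected two-path-free digraph with ≥ 2 vertices every vertex is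
--     a source or a sink, which gives the bipartition;
-- (5) with no two-paths, g x is either x or a sink, which g fixes, so g² = g.
-- Only (3) uses acyclicity and only (4) uses connectivity and the vertex count.

open import Defs
open import Data.Nat using (ℕ; _≥_; s≤s)
open import Data.Nat.Properties using (≤-trans; n≤1+n)
open import Data.Fin using (Fin; _≟_) renaming (zero to fzero; suc to fsuc)
open import Data.Bool using (Bool; true; false)
open import Data.Product using (_×_; _,_; ∃; proj₁; proj₂)
open import Data.Sum using (_⊎_; inj₁; inj₂)
open import Data.Empty using (⊥; ⊥-elim)
open import Function using (_∘_)
open import Function.Bundles using (_⇔_; mk⇔)
open import Relation.Nullary using (yes; no)
open import Relation.Binary.PropositionalEquality
  using (_≡_; _≢_; _≗_; refl; sym; trans; cong; subst; module ≡-Reasoning)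
open import Relation.Binary.Construct.Closure.Transitive using (TransClosure; [_]; _∷_)
open import Relation.Binary.Construct.Closure.Symmetric using (SymClosure; fwd; bwd)
open import Relation.Binary.Construct.Closure.ReflexiveTransitive using (Star; ε; _◅_; _◅◅_)

edgeTr-source : ∀ {n} (a b : Fin n) → edgeTr a b a ≡ b
edgeTr-source a b with a ≟ a
... | yes _   = refl
... | no  a≢a = ⊥-elim (a≢a refl)

edgeTr-fixes : ∀ {n} (a b : Fin n) {x} → x ≢ a → edgeTr a b x ≡ x
edgeTr-fixes a b {x} x≢a with x ≟ a
... | yes x≡a = ⊥-elim (x≢a x≡a)
... | no  _   = refl

otherVertex : ∀ {n} → n ≥ 2 → (v : Fin n) → ∃ λ w → w ≢ v
otherVertex (s≤s (s≤s _)) fzero    = fsuc fzero , λ ()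
otherVertex (s≤s (s≤s _)) (fsuc _) = fzero , λ ()

module _ {n : ℕ} (D : Digraph n) where

  arc◅walk : ∀ {u v w} → Arc D u v → Star (Arc D) v w → TransClosure (Arc D) u w
  arc◅walk uv ε         = [ uv ]
  arc◅walk uv (vv' ◅ p) = uv ∷ arc◅walk vv' p

  trajectory : ∀ {g} → InGen D g → ∀ x → Star (Arc D) x (g x)
  trajectory (gen {a} ab) x with x ≟ a
  ... | yes refl = ab ◅ ε
  ... | no  _    = ε
  trajectory (comp {f} {g} pf pg) x = trajectory pf x ◅◅ trajectory pg (f x)

  Sink : Fin n → Set
  Sink v = ∃ λ u → Arc D u v

  Source : Fin n → Set
  Source v = ∃ λ w → Arc D v w

  TwoPathFree : Set
  TwoPathFree = ∀ {a b c} → Arc D a b → Arc D b c → ⊥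

  idempotent⇒inSubgroup : ∀ f → InGen D f → (f ⨟ f) ≗ f →
    ∃ λ H → IsSubgroup D H × H f
  idempotent⇒inSubgroup f pf ff≗f =
    H , ((λ _ → proj₁) , closed , f , (pf , λ _ → refl) , identity , inverse)
      , (pf , λ _ → refl)
    where
    H : Tr n → Set
    H h = InGen D h × (h ≗ f)

    product≗f : ∀ {h k} → h ≗ f → k ≗ f → (h ⨟ k) ≗ f
    product≗f {h} {k} h≗f k≗f x = begin
      k (h x) ≡⟨ k≗f (h x) ⟩
      f (h x) ≡⟨ cong f (h≗f x) ⟩
      f (f x) ≡⟨ ff≗f x ⟩
      f x     ∎
      where open ≡-Reasoning

    closed : ∀ h k → H h → H k → H (h ⨟ k)
    closed _ _ (ph , h≗f) (pk , k≗f) = comp ph pk , product≗f h≗f k≗f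

    identity : ∀ h → H h → ((f ⨟ h) ≗ h) × ((h ⨟ f) ≗ h)
    identity _ (_ , h≗f) =
      (λ x → trans (product≗f (λ _ → refl) h≗f x) (sym (h≗f x))) ,
      (λ x → trans (product≗f h≗f (λ _ → refl) x) (sym (h≗f x)))

    inverse : ∀ h → H h → ∃ λ h' → H h' × ((h ⨟ h') ≗ f) × ((h' ⨟ h) ≗ f)
    inverse _ (_ , h≗f) =
      f , (pf , λ _ → refl) , product≗f h≗f (λ _ → refl) , product≗f (λ _ → refl) h≗f

  band⇒completelyRegular : IsBand D → IsCompletelyRegular D
  band⇒completelyRegular band f pf = idempotent⇒inSubgroup f pf (band f pf)

  -- (2) The group inverse of f in its subgroup is a regular inverse: f f' f = e f = f.
  completelyRegular⇒regular : IsCompletelyRegular D → IsRegular D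
  completelyRegular⇒regular cr f pf
    with cr f pf
  ... | H , (inGen , _ , e , _ , identity , inverse) , Hf
    with inverse f Hf
  ... | f' , Hf' , ff'≗e , _ =
    f' , inGen f' Hf' , λ x → trans (cong f (ff'≗e x)) (proj₁ (identity f Hf) x)

  regular⇒twoPathFree : Acyclic D → IsRegular D → TwoPathFree
  regular⇒twoPathFree acyclic regular {a} {b} {c} ab bc
    with regular (edgeTr b c ⨟ edgeTr a b) (comp (gen bc) (gen ab))
  ... | g , pg , fgf≗f =
    acyclic a (arc◅walk ab (subst (Star (Arc D) b) (onlyPreimage (g b) fgb≡b) (trajectory pg b)))
    where
    f : Tr n
    f = edgeTr b c ⨟ edgeTr a b

    a≢b : a ≢ b
    a≢b refl = noLoops D a ab

    c≢a : c ≢ a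
    c≢a refl = acyclic a (ab ∷ [ bc ])

    fa≡b : f a ≡ b
    fa≡b = trans (cong (edgeTr a b) (edgeTr-fixes b c a≢b)) (edgeTr-source a b)

    -- f g f = f evaluated at a gives f (g b) = b.
    fgb≡b : f (g b) ≡ b
    fgb≡b = begin
      f (g b)     ≡⟨ cong (λ y → f (g y)) (sym fa≡b) ⟩
      f (g (f a)) ≡⟨ fgf≗f a ⟩
      f a         ≡⟨ fa≡b ⟩
      b           ∎
      where open ≡-Reasoning

    -- a is the only point that f sends to b.  Each case split on y also
    -- evaluates f y inside fy≡b: f b = (a→b) c = c ≠ b, and f y = y otherwise.
    onlyPreimage : ∀ y → f y ≡ b → y ≡ a
    onlyPreimage y fy≡b with y ≟ b
    ... | yes refl = ⊥-elim (noLoops D b (subst (Arc D b) c≡b bc))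
      where
      c≡b : c ≡ b
      c≡b = trans (sym (edgeTr-fixes a b c≢a)) fy≡b
    ... | no y≢b with y ≟ a
    ...   | yes y≡a = y≡a
    ...   | no  _   = ⊥-elim (y≢b fy≡b)

  incident : Connected D → ∀ {v} → (∃ λ w → w ≢ v) → Source v ⊎ Sink v
  incident connected {v} (w , w≢v) = firstStep (connected v w)
    where
    firstStep : Star (SymClosure (Arc D)) v w → Source v ⊎ Sink v
    firstStep ε            = ⊥-elim (w≢v refl)
    firstStep (fwd vu ◅ _) = inj₁ (_ , vu)
    firstStep (bwd uv ◅ _) = inj₂ (_ , uv)

  -- (4) Colour sources by V₁ and sinks by V₂; two-path-freeness makes this consistent.
  twoPathFree⇒bipartite : n ≥ 2 → Connected D → TwoPathFree → DirectedBipartite D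
  twoPathFree⇒bipartite n≥2 connected noTwoPath =
    (λ v → colour (kind v)) , λ a b ab → tailColour ab (kind a) , headColour ab (kind b)
    where
    kind : ∀ v → Source v ⊎ Sink v
    kind v = incident connected (otherVertex n≥2 v)

    colour : ∀ {v} → Source v ⊎ Sink v → Bool
    colour (inj₁ _) = true
    colour (inj₂ _) = false

    tailColour : ∀ {a b} → Arc D a b → (k : Source a ⊎ Sink a) → colour k ≡ true
    tailColour ab (inj₁ _)        = refl
    tailColour ab (inj₂ (_ , ua)) = ⊥-elim (noTwoPath ua ab)

    headColour : ∀ {a b} → Arc D a b → (k : Source b ⊎ Sink b) → colour k ≡ false
    headColour ab (inj₁ (_ , bw)) = ⊥-elim (noTwoPath ab bw)
    headColour ab (inj₂ _)        = refl

  -- A middle vertex b of a → b → c would have to lie in both V₂ and V₁.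
  bipartite⇒twoPathFree : DirectedBipartite D → TwoPathFree
  bipartite⇒twoPathFree (_ , split) ab bc
    with trans (sym (proj₁ (split _ _ bc))) (proj₂ (split _ _ ab))
  ... | ()

  walkEnd : ∀ {x y} → Star (Arc D) x y → y ≡ x ⊎ Sink y
  walkEnd ε = inj₁ refl
  walkEnd (xz ◅ p) with walkEnd p
  ... | inj₁ refl = inj₂ (_ , xz)
  ... | inj₂ sink = inj₂ sink

  -- Without two-paths, a sink has no outgoing arc, so walks from it are trivial.
  sinkWalk : TwoPathFree → ∀ {x y} → Sink x → Star (Arc D) x y → y ≡ x
  sinkWalk _         _        ε        = refl
  sinkWalk noTwoPath (_ , ux) (xz ◅ _) = ⊥-elim (noTwoPath ux xz)

  -- (5) g x is x or a sink; in both cases g fixes it, so g (g x) = g x.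
  twoPathFree⇒band : TwoPathFree → IsBand D
  twoPathFree⇒band noTwoPath g pg x with walkEnd (trajectory pg x)
  ... | inj₁ gx≡x = cong g gx≡x
  ... | inj₂ sink = sinkWalk noTwoPath sink (trajectory pg (g x))

corollary5p2 : (n : ℕ) → n ≥ 3 → (D : Digraph n) → Connected D → Acyclic D →
    (IsBand D ⇔ IsCompletelyRegular D) × (IsCompletelyRegular D ⇔ IsRegular D) ×
    (IsRegular D ⇔ DirectedBipartite D)
corollary5p2 n n≥3 D connected acyclic =
    mk⇔ band⇒cr (regular⇒band ∘ cr⇒regular) ,
    mk⇔ cr⇒regular (band⇒cr ∘ regular⇒band) ,
    mk⇔ regular⇒bipartite (cr⇒regular ∘ band⇒cr ∘ bipartite⇒band)
  where
  band⇒cr : IsBand D → IsCompletelyRegular D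
  band⇒cr = band⇒completelyRegular D

  cr⇒regular : IsCompletelyRegular D → IsRegular D
  cr⇒regular = completelyRegular⇒regular D

  regular⇒bipartite : IsRegular D → DirectedBipartite D
  regular⇒bipartite = twoPathFree⇒bipartite D (≤-trans (n≤1+n 2) n≥3) connected
                    ∘ regular⇒twoPathFree D acyclic

  bipartite⇒band : DirectedBipartite D → IsBand D
  bipartite⇒band = twoPathFree⇒band D ∘ bipartite⇒twoPathFree D

  regular⇒band : IsRegular D → IsBand D
  regular⇒band = bipartite⇒band ∘ regular⇒bipartite
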